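{- Let $\mathbb{F}_q$ be a finite field of odd characteristic, and let $a_1,a_3,a_4,a_5,b_1,\dots,b_5\in\mathbb{F}_q$. The polynomial system $(f_1,f_2)$ with $$f_1(x,y)=a_1x^2+a_3y^2+a_4x+a_5y,\qquad f_2(x,y)=b_1x^2+b_2xy+b_3y^2+b_4x+b_5y$$ is a permutation of $\mathbb{F}_q^2$ if and only if, possibly after interchanging the roles of the variables $x$ and $y$, one of the following holds: (i) $f_1=a_5y$ with $a_5\neq0$, and $f_2=b_3y^2+b_4x+b_5y$ with $b_4\neq0$; (ii) $f_1=a_3y^2+a_4x+a_5y$ with $a_3\neq0$ and $a_4\neq0$, and $f_2=b_3y^2+b_4x+b_5y$ with $a_3b_4-a_4b_3=0$ and $a_4b_5-a_5b_4\neq0$; (iii) $f_1=a_4x+a_5y$ with $a_4\neq0$ and $a_5\neq0$, and $f_2=b_1x^2+b_2xy+b_3y^2+b_4x+b_5y$ with $a_5^2b_1-a_4a_5b_2+b_3a_4^2=0$, $b_2a_5-2a_4b_3=0$ and $a_4b_5-a_5b_4\neq0$.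
   Context: A system $(f_1,f_2)$ with $f_i\in\mathbb{F}_q[x,y]$ is a permutation of $\mathbb{F}_q^2$ if for every $(u,v)\in\mathbb{F}_q^2$ the system $f_1(x,y)=u$, $f_2(x,y)=v$ has exactly one solution $(x,y)\in\mathbb{F}_q^2$. -}

module Defs where

open import Level using (Level; _⊔_; suc)
open import Algebra.Bundles using (CommutativeRing)
open import Data.Nat using (ℕ)
open import Data.Fin using (Fin)
open import Data.Product using (Σ; ∃; _×_; _,_)
open import Data.Sum using (_⊎_)
open import Relation.Nullary using (¬_)
open import Relation.Binary.Definitions using (Decidable)

record FiniteField (c ℓ : Level) : Set (suc (c ⊔ ℓ)) where
  field
    commRing : CommutativeRing c ℓ
  open CommutativeRing commRing public
  field
    1≉0      : ¬ (1# ≈ 0#)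
    inverse  : ∀ x → ¬ (x ≈ 0#) → ∃ λ y → (x * y) ≈ 1#
    _≟_      : Decidable _≈_
    size     : ℕ
    enum     : Fin size → Carrier
    enum-surj : ∀ x → ∃ λ i → enum i ≈ x

-- Odd characteristic: 2 = 1 + 1 is nonzero (for a finite field of prime
-- characteristic p this is exactly p ≠ 2).
OddCharacteristic : ∀ {c ℓ} → FiniteField c ℓ → Set ℓ
OddCharacteristic F = ¬ ((1# + 1#) ≈ 0#)
  where open FiniteField F

module _ {c ℓ} (F : FiniteField c ℓ) where
  open FiniteField F

  IsPermutation² : (Carrier → Carrier → Carrier) → (Carrier → Carrier → Carrier) → Set (c ⊔ ℓ)
  IsPermutation² f₁ f₂ =
    ∀ u v → Σ (Carrier × Carrier) (λ { (x , y) →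
              (f₁ x y ≈ u × f₂ x y ≈ v) ×
              (∀ x′ y′ → f₁ x′ y′ ≈ u → f₂ x′ y′ ≈ v → (x′ ≈ x × y′ ≈ y)) })

  F₁ : (a₁ a₃ a₄ a₅ : Carrier) → Carrier → Carrier → Carrier
  F₁ a₁ a₃ a₄ a₅ x y = a₁ * (x * x) + a₃ * (y * y) + a₄ * x + a₅ * y

  F₂ : (b₁ b₂ b₃ b₄ b₅ : Carrier) → Carrier → Carrier → Carrier
  F₂ b₁ b₂ b₃ b₄ b₅ x y =
    b₁ * (x * x) + b₂ * (x * y) + b₃ * (y * y) + b₄ * x + b₅ * y

  Cond-i : (a₁ a₃ a₄ a₅ b₁ b₂ b₃ b₄ b₅ : Carrier) → Set ℓ
  Cond-i a₁ a₃ a₄ a₅ b₁ b₂ b₃ b₄ b₅ =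
    a₁ ≈ 0# × a₃ ≈ 0# × a₄ ≈ 0# × ¬ (a₅ ≈ 0#) ×
    b₁ ≈ 0# × b₂ ≈ 0# × ¬ (b₄ ≈ 0#)

  Cond-ii : (a₁ a₃ a₄ a₅ b₁ b₂ b₃ b₄ b₅ : Carrier) → Set ℓ
  Cond-ii a₁ a₃ a₄ a₅ b₁ b₂ b₃ b₄ b₅ =
    a₁ ≈ 0# × ¬ (a₃ ≈ 0#) × ¬ (a₄ ≈ 0#) ×
    b₁ ≈ 0# × b₂ ≈ 0# ×
    (a₃ * b₄ - a₄ * b₃) ≈ 0# × ¬ ((a₄ * b₅ - a₅ * b₄) ≈ 0#)

  Cond-iii : (a₁ a₃ a₄ a₅ b₁ b₂ b₃ b₄ b₅ : Carrier) → Set ℓ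
  Cond-iii a₁ a₃ a₄ a₅ b₁ b₂ b₃ b₄ b₅ =
    a₁ ≈ 0# × a₃ ≈ 0# × ¬ (a₄ ≈ 0#) × ¬ (a₅ ≈ 0#) ×
    (a₅ * a₅ * b₁ - a₄ * a₅ * b₂ + b₃ * (a₄ * a₄)) ≈ 0# ×
    (b₂ * a₅ - (1# + 1#) * a₄ * b₃) ≈ 0# ×
    ¬ ((a₄ * b₅ - a₅ * b₄) ≈ 0#)

  Cond : (a₁ a₃ a₄ a₅ b₁ b₂ b₃ b₄ b₅ : Carrier) → Set ℓ
  Cond a₁ a₃ a₄ a₅ b₁ b₂ b₃ b₄ b₅ =
    Cond-i a₁ a₃ a₄ a₅ b₁ b₂ b₃ b₄ b₅ ⊎
    Cond-ii a₁ a₃ a₄ a₅ b₁ b₂ b₃ b₄ b₅ ⊎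
    Cond-iii a₁ a₃ a₄ a₅ b₁ b₂ b₃ b₄ b₅

  -- "possibly after interchanging x and y": swapping x ↔ y turns
  -- (a₁,a₃,a₄,a₅; b₁,b₂,b₃,b₄,b₅) into (a₃,a₁,a₅,a₄; b₃,b₂,b₁,b₅,b₄).
  CondUpToSwap : (a₁ a₃ a₄ a₅ b₁ b₂ b₃ b₄ b₅ : Carrier) → Set ℓ
  CondUpToSwap a₁ a₃ a₄ a₅ b₁ b₂ b₃ b₄ b₅ =
    Cond a₁ a₃ a₄ a₅ b₁ b₂ b₃ b₄ b₅ ⊎
    Cond a₃ a₁ a₅ a₄ b₃ b₂ b₁ b₅ b₄

{-# OPTIONS --safe #-}
-- If (f₁ , f₂) permutes F², it is injective, so for every direction d ≠ 0 the increments
-- fᵢ (p + d) - fᵢ p, which are affine in p because the fᵢ are quadratic, never vanish together.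
-- When f₁ contains x² this forces the 2 × 2 increment system in every direction (1 , t) to be
-- singular with inconsistent right-hand side; when f₁ = a₄ x + a₅ y it forces the increment of
-- f₂ along the kernel direction (a₅ , - a₄) to be a nonzero constant. Conversely, under (i)–(iii) the invertible change of
-- target coordinates (u , v) ↦ (μ v - P u , u) turns (f₁ , f₂) into a triangular map
-- (κ y , ν x + G y) with κ , ν ≠ 0. Odd characteristic is used to divide by 2.
module Submission where

open import Defs
open import Level using (Level; _⊔_)
open import Algebra.Bundles using (CommutativeRing)
open import Algebra.Solver.Ring.AlmostCommutativeRing
  using (fromCommutativeRing; _-Raw-AlmostCommutative⟶_)
open import Data.Empty using (⊥-elim)
open import Data.Integer as ℤ using (ℤ; +_; -[1+_])
import Data.Integer.Properties as ℤ
open import Data.Maybe as Maybe using (Maybe)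
open import Data.Nat as ℕ using (zero; suc)
import Data.Nat.Properties as ℕ
open import Data.Product using (Σ; ∃; _×_; _,_; proj₁; proj₂; uncurry; swap)
open import Data.Sign as Sign using (Sign)
open import Data.Sum using (inj₁; inj₂)
open import Function using (_∘_; flip)
open import Function.Bundles using (_⇔_; mk⇔)
open import Relation.Binary.Consequences using (dec⇒weaklyDec)
import Relation.Binary.PropositionalEquality as ≡
open import Relation.Nullary using (¬_; yes; no)
open import Relation.Nullary.Decidable using (decidable-stable)

-- The standard library's ring solver needs a coefficient ring with decidable equality;
-- we take ℤ, interpreted through the canonical map ℤ → R.
module IntegerCoefficients {c ℓ} (R : CommutativeRing c ℓ) where
  open CommutativeRing R
  open import Algebra.Properties.Ring ring using (-‿distribˡ-*; -‿distribʳ-*)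
  open import Algebra.Properties.AbelianGroup +-abelianGroup
    using (⁻¹-∙-comm; ε⁻¹≈ε; ⁻¹-involutive)
  open import Algebra.Properties.Semiring.Mult.TCOptimised semiring
    using (×-homo-+; ×1-homo-*) renaming (_×_ to _·_)
  open import Relation.Binary.Reasoning.Setoid setoid

  -- The optimised _·_ makes ⟦ + 2 ⟧ℤ reduce to exactly 1# + 1#, so con (+ 2) stands for two.
  ⟦_⟧ℤ : ℤ → Carrier
  ⟦ + n ⟧ℤ      = n · 1#
  ⟦ -[1+ n ] ⟧ℤ = - (suc n · 1#)

  private
    signed : Sign → Carrier → Carrier
    signed Sign.+ x = x
    signed Sign.- x = - x

    signed-cong : ∀ s {x y} → x ≈ y → signed s x ≈ signed s y
    signed-cong Sign.+ x≈y = x≈y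
    signed-cong Sign.- x≈y = -‿cong x≈y

    signed-* : ∀ s t x y → signed (s Sign.* t) (x * y) ≈ signed s x * signed t y
    signed-* Sign.+ Sign.+ x y = refl
    signed-* Sign.+ Sign.- x y = -‿distribʳ-* x y
    signed-* Sign.- Sign.+ x y = -‿distribˡ-* x y
    signed-* Sign.- Sign.- x y = begin
      x * y        ≈⟨ ⁻¹-involutive (x * y) ⟨
      - - (x * y)  ≈⟨ -‿cong (-‿distribˡ-* x y) ⟩
      - (- x * y)  ≈⟨ -‿distribʳ-* (- x) y ⟩
      - x * - y    ∎

    ⟦◃⟧ : ∀ s n → ⟦ s ℤ.◃ n ⟧ℤ ≈ signed s (n · 1#)
    ⟦◃⟧ Sign.+ zero    = refl
    ⟦◃⟧ Sign.- zero    = sym ε⁻¹≈ε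
    ⟦◃⟧ Sign.+ (suc n) = refl
    ⟦◃⟧ Sign.- (suc n) = refl

    ⟦⟧≈signed : ∀ i → ⟦ i ⟧ℤ ≈ signed (ℤ.sign i) (ℤ.∣ i ∣ · 1#)
    ⟦⟧≈signed (+ n)    = refl
    ⟦⟧≈signed -[1+ n ] = refl

    [1+x]-[1+y]≈x-y : ∀ x y → (1# + x) - (1# + y) ≈ x - y
    [1+x]-[1+y]≈x-y x y = begin
      (1# + x) - (1# + y)      ≈⟨ +-cong (+-comm x 1#) (⁻¹-∙-comm 1# y) ⟨
      (x + 1#) + (- 1# + - y)  ≈⟨ +-assoc x 1# _ ⟩
      x + (1# + (- 1# + - y))  ≈⟨ +-congˡ (+-assoc 1# (- 1#) (- y)) ⟨
      x + ((1# - 1#) + - y)    ≈⟨ +-congˡ (+-congʳ (-‿inverseʳ 1#)) ⟩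
      x + (0# + - y)           ≈⟨ +-congˡ (+-identityˡ (- y)) ⟩
      x - y                    ∎

    ⟦⊖⟧ : ∀ m n → ⟦ m ℤ.⊖ n ⟧ℤ ≈ m · 1# - n · 1#
    ⟦⊖⟧ m       zero    = sym (trans (+-congˡ ε⁻¹≈ε) (+-identityʳ _))
    ⟦⊖⟧ zero    (suc n) = sym (+-identityˡ _)
    ⟦⊖⟧ (suc m) (suc n) = begin
      ⟦ suc m ℤ.⊖ suc n ⟧ℤ           ≡⟨ ≡.cong ⟦_⟧ℤ (ℤ.[1+m]⊖[1+n]≡m⊖n m n) ⟩
      ⟦ m ℤ.⊖ n ⟧ℤ                   ≈⟨ ⟦⊖⟧ m n ⟩
      m · 1# - n · 1#                ≈⟨ [1+x]-[1+y]≈x-y _ _ ⟨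
      (1# + m · 1#) - (1# + n · 1#)  ≈⟨ +-cong (×-homo-+ 1# 1 m) (-‿cong (×-homo-+ 1# 1 n)) ⟨
      suc m · 1# - suc n · 1#        ∎

  +-homo : ∀ i j → ⟦ i ℤ.+ j ⟧ℤ ≈ ⟦ i ⟧ℤ + ⟦ j ⟧ℤ
  +-homo -[1+ m ] -[1+ n ] = begin
    - (suc (suc (m ℕ.+ n)) · 1#)     ≡⟨ ≡.cong (λ k → - (suc k · 1#)) (ℕ.+-suc m n) ⟨
    - ((suc m ℕ.+ suc n) · 1#)       ≈⟨ -‿cong (×-homo-+ 1# (suc m) (suc n)) ⟩
    - (suc m · 1# + suc n · 1#)      ≈⟨ ⁻¹-∙-comm _ _ ⟨
    - (suc m · 1#) + - (suc n · 1#)  ∎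
  +-homo -[1+ m ] (+ n)    = trans (⟦⊖⟧ n (suc m)) (+-comm _ _)
  +-homo (+ m)    -[1+ n ] = ⟦⊖⟧ m (suc n)
  +-homo (+ m)    (+ n)    = ×-homo-+ 1# m n

  *-homo : ∀ i j → ⟦ i ℤ.* j ⟧ℤ ≈ ⟦ i ⟧ℤ * ⟦ j ⟧ℤ
  *-homo i j = begin
    ⟦ i ℤ.* j ⟧ℤ                                ≈⟨ ⟦◃⟧ (s Sign.* t) (∣i∣ ℕ.* ∣j∣) ⟩
    signed (s Sign.* t) ((∣i∣ ℕ.* ∣j∣) · 1#)    ≈⟨ signed-cong (s Sign.* t) (×1-homo-* ∣i∣ ∣j∣) ⟩
    signed (s Sign.* t) (∣i∣ · 1# * ∣j∣ · 1#)   ≈⟨ signed-* s t _ _ ⟩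
    signed s (∣i∣ · 1#) * signed t (∣j∣ · 1#)   ≈⟨ *-cong (⟦⟧≈signed i) (⟦⟧≈signed j) ⟨
    ⟦ i ⟧ℤ * ⟦ j ⟧ℤ                              ∎
    where
      s = ℤ.sign i
      t = ℤ.sign j
      ∣i∣ = ℤ.∣ i ∣
      ∣j∣ = ℤ.∣ j ∣

  -‿homo : ∀ i → ⟦ ℤ.- i ⟧ℤ ≈ - ⟦ i ⟧ℤ
  -‿homo -[1+ n ]    = sym (⁻¹-involutive _)
  -‿homo (+ zero)    = sym ε⁻¹≈ε
  -‿homo (+ (suc n)) = refl

  ℤ⟶R : ℤ.+-*-rawRing -Raw-AlmostCommutative⟶ fromCommutativeRing R
  ℤ⟶R = record
    { ⟦_⟧    = ⟦_⟧ℤ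
    ; +-homo = +-homo
    ; *-homo = *-homo
    ; -‿homo = -‿homo
    ; 0-homo = refl
    ; 1-homo = refl
    }

  ⟦⟧-weaklyDec : ∀ i j → Maybe (⟦ i ⟧ℤ ≈ ⟦ j ⟧ℤ)
  ⟦⟧-weaklyDec i j = Maybe.map (λ { ≡.refl → refl }) (dec⇒weaklyDec ℤ._≟_ i j)

  open import Algebra.Solver.Ring ℤ.+-*-rawRing (fromCommutativeRing R) ℤ⟶R ⟦⟧-weaklyDec public

module FieldLemmas {c ℓ} (F : FiniteField c ℓ) where
  open FiniteField F
  open IntegerCoefficients commRing using (solve; _:=_; _:+_; _:*_; _:-_)
  open import Algebra.Properties.Group +-group using (ε⁻¹≈ε)
  open import Relation.Binary.Reasoning.Setoid setoid

  private variable a b p q r x y p₁ q₁ r₁ p₂ q₂ r₂ : Carrier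

  two : Carrier
  two = 1# + 1#

  division : ¬ a ≈ 0# → ∀ z → ∃ λ x → a * x ≈ z
  division {a} a≉0 z = a⁻¹ * z , (begin
      a * (a⁻¹ * z)  ≈⟨ *-assoc a a⁻¹ z ⟨
      a * a⁻¹ * z    ≈⟨ *-congʳ aa⁻¹≈1 ⟩
      1# * z         ≈⟨ *-identityˡ z ⟩
      z              ∎)
    where open Σ (inverse a a≉0) renaming (proj₁ to a⁻¹; proj₂ to aa⁻¹≈1)

  *-cancelˡ : ¬ a ≈ 0# → a * x ≈ a * y → x ≈ y
  *-cancelˡ {a} {x} {y} a≉0 ax≈ay = begin
      x              ≈⟨ a⁻¹[a*z]≈z x ⟨
      a⁻¹ * (a * x)  ≈⟨ *-congˡ ax≈ay ⟩
      a⁻¹ * (a * y)  ≈⟨ a⁻¹[a*z]≈z y ⟩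
      y              ∎
    where
      open Σ (inverse a a≉0) renaming (proj₁ to a⁻¹; proj₂ to aa⁻¹≈1)
      a⁻¹[a*z]≈z : ∀ z → a⁻¹ * (a * z) ≈ z
      a⁻¹[a*z]≈z z = begin
        a⁻¹ * (a * z)  ≈⟨ *-assoc a⁻¹ a z ⟨
        a⁻¹ * a * z    ≈⟨ *-congʳ (trans (*-comm a⁻¹ a) aa⁻¹≈1) ⟩
        1# * z         ≈⟨ *-identityˡ z ⟩
        z              ∎

  a*x≈0⇒x≈0 : ¬ a ≈ 0# → a * x ≈ 0# → x ≈ 0#
  a*x≈0⇒x≈0 {a} a≉0 ax≈0 = *-cancelˡ a≉0 (trans ax≈0 (sym (zeroʳ a)))

  *-≉0 : ¬ a ≈ 0# → ¬ b ≈ 0# → ¬ a * b ≈ 0#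
  *-≉0 a≉0 b≉0 ab≈0 = b≉0 (a*x≈0⇒x≈0 a≉0 ab≈0)

  w+a*x≈w : x ≈ 0# → ∀ w a → w + a * x ≈ w
  w+a*x≈w x≈0 w a = trans (+-congˡ (trans (*-congˡ x≈0) (zeroʳ a))) (+-identityʳ w)

  w-a*x≈w : x ≈ 0# → ∀ w a → w - a * x ≈ w
  w-a*x≈w x≈0 w a =
    trans (+-congˡ (trans (-‿cong (trans (*-congˡ x≈0) (zeroʳ a))) ε⁻¹≈ε)) (+-identityʳ w)

  linear-root : ¬ a ≈ 0# → ∀ b → ∃ λ x → a * x + b ≈ 0#
  linear-root a≉0 b =
    let x , ax≈-b = division a≉0 (- b) in x , trans (+-congʳ ax≈-b) (-‿inverseˡ b)

  linear-nonvanishing : (∀ x → ¬ a * x + b ≈ 0#) → a ≈ 0#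
  linear-nonvanishing {a} {b} no-root =
    decidable-stable (a ≟ 0#) (λ a≉0 → uncurry no-root (linear-root a≉0 b))

  affine : (p q r x y : Carrier) → Carrier
  affine p q r x y = p * x + q * y + r

  affine[x,0] : affine p q r x 0# ≈ p * x + r
  affine[x,0] {q = q} = +-congʳ (trans (+-congˡ (zeroʳ q)) (+-identityʳ _))

  affine[0,y] : affine p q r 0# y ≈ q * y + r
  affine[0,y] {p = p} = +-congʳ (trans (+-congʳ (zeroʳ p)) (+-identityˡ _))

  affine[0,0] : affine p q r 0# 0# ≈ r
  affine[0,0] {q = q} {r = r} = trans affine[0,y] (trans (+-congʳ (zeroʳ q)) (+-identityˡ r))

  nonvanishing-affine : (∀ x y → ¬ affine p q r x y ≈ 0#) → p ≈ 0# × q ≈ 0# × ¬ r ≈ 0#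
  nonvanishing-affine no-root =
      linear-nonvanishing (λ x → no-root x 0# ∘ trans affine[x,0])
    , linear-nonvanishing (λ y → no-root 0# y ∘ trans affine[0,y])
    , no-root 0# 0# ∘ trans affine[0,0]

  -- Solve the first equation for x and substitute into the second.
  no-common-zero⇒singular :
    ¬ p₁ ≈ 0# →
    (∀ x y → affine p₁ q₁ r₁ x y ≈ 0# → ¬ affine p₂ q₂ r₂ x y ≈ 0#) →
    p₁ * q₂ - p₂ * q₁ ≈ 0# × ¬ p₁ * r₂ - p₂ * r₁ ≈ 0#
  no-common-zero⇒singular {p₁} {q₁} {r₁} {p₂} {q₂} {r₂} p₁≉0 disjoint =
    linear-nonvanishing no-root , no-root 0# ∘ trans (trans (+-congʳ (zeroʳ _)) (+-identityˡ _))
    where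
      eliminate-x : ∀ p₁ q₁ r₁ p₂ q₂ r₂ x y →
        p₁ * affine p₂ q₂ r₂ x y ≈
        p₂ * affine p₁ q₁ r₁ x y + ((p₁ * q₂ - p₂ * q₁) * y + (p₁ * r₂ - p₂ * r₁))
      eliminate-x =
        solve 8 (λ p₁ q₁ r₁ p₂ q₂ r₂ x y →
          p₁ :* (p₂ :* x :+ q₂ :* y :+ r₂)
          := p₂ :* (p₁ :* x :+ q₁ :* y :+ r₁) :+ ((p₁ :* q₂ :- p₂ :* q₁) :* y :+ (p₁ :* r₂
          :- p₂ :* r₁))) refl

      no-root : ∀ y → ¬ (p₁ * q₂ - p₂ * q₁) * y + (p₁ * r₂ - p₂ * r₁) ≈ 0#
      no-root y root = disjoint x₀ y first≈0 (a*x≈0⇒x≈0 p₁≉0 (begin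
        p₁ * affine p₂ q₂ r₂ x₀ y
          ≈⟨ eliminate-x p₁ q₁ r₁ p₂ q₂ r₂ x₀ y ⟩
        p₂ * affine p₁ q₁ r₁ x₀ y + ((p₁ * q₂ - p₂ * q₁) * y + (p₁ * r₂ - p₂ * r₁))
          ≈⟨ +-cong (*-congˡ first≈0) root ⟩
        p₂ * 0# + 0#
          ≈⟨ trans (+-identityʳ _) (zeroʳ p₂) ⟩
        0# ∎))
        where
          x₀ : Carrier
          x₀ = proj₁ (linear-root p₁≉0 (q₁ * y + r₁))
          first≈0 : affine p₁ q₁ r₁ x₀ y ≈ 0#
          first≈0 = trans (+-assoc _ _ _) (proj₂ (linear-root p₁≉0 (q₁ * y + r₁)))

module PermutationLemmas {c ℓ} (F : FiniteField c ℓ) where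
  open FiniteField F
  open FieldLemmas F
  open import Algebra.Properties.Group +-group using (//-rightDividesˡ; ∙-cancelˡ; ∙-cancelʳ)

  private variable
    f₁ f₂ g₁ g₂ : Carrier → Carrier → Carrier
    d₁ d₂ p q r p₁ q₁ r₁ p₂ q₂ r₂ x y : Carrier

  IsPermutation²-resp : (∀ x y → f₁ x y ≈ g₁ x y) → (∀ x y → f₂ x y ≈ g₂ x y) →
    IsPermutation² F f₁ f₂ → IsPermutation² F g₁ g₂
  IsPermutation²-resp f₁≈g₁ f₂≈g₂ perm u v with perm u v
  ... | (x , y) , (f₁≈u , f₂≈v) , unique =
    (x , y) , (trans (sym (f₁≈g₁ x y)) f₁≈u , trans (sym (f₂≈g₂ x y)) f₂≈v) ,
    λ x′ y′ g₁≈u g₂≈v → unique x′ y′ (trans (f₁≈g₁ x′ y′) g₁≈u) (trans (f₂≈g₂ x′ y′) g₂≈v)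

  IsPermutation²-flip : IsPermutation² F f₁ f₂ → IsPermutation² F (flip f₁) (flip f₂)
  IsPermutation²-flip perm u v with perm u v
  ... | (x , y) , f≈uv , unique =
    (y , x) , f≈uv , λ y′ x′ f₁≈u f₂≈v → swap (unique x′ y′ f₁≈u f₂≈v)

  IsPermutation²⇒injective : IsPermutation² F f₁ f₂ → ∀ {x y x′ y′} →
    f₁ x′ y′ ≈ f₁ x y → f₂ x′ y′ ≈ f₂ x y → x′ ≈ x × y′ ≈ y
  IsPermutation²⇒injective {f₁ = f₁} {f₂ = f₂} perm {x} {y} {x′} {y′} e₁ e₂
    with perm (f₁ x y) (f₂ x y)
  ... | _ , _ , unique =
    let x≈x₀ , y≈y₀ = unique x y refl refl
        x′≈x₀ , y′≈y₀ = unique x′ y′ e₁ e₂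
    in trans x′≈x₀ (sym x≈x₀) , trans y′≈y₀ (sym y≈y₀)

  IsPermutation²-eliminate : ∀ {μ} {P : Carrier → Carrier} → ¬ μ ≈ 0# →
    (∀ {u u′} → u ≈ u′ → P u ≈ P u′) →
    IsPermutation² F (λ x y → μ * f₂ x y - P (f₁ x y)) f₁ → IsPermutation² F f₁ f₂
  IsPermutation²-eliminate {f₂ = f₂} {f₁ = f₁} {μ} {P} μ≉0 P-cong perm u v
    with perm (μ * v - P u) u
  ... | (x , y) , (μf₂-Pf₁≈μv-Pu , f₁≈u) , unique = (x , y) , (f₁≈u , f₂≈v) , unique′
    where
      f₂≈v : f₂ x y ≈ v
      f₂≈v = *-cancelˡ μ≉0 (∙-cancelʳ (- P u) _ _
        (trans (+-congˡ (-‿cong (P-cong (sym f₁≈u)))) μf₂-Pf₁≈μv-Pu))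
      unique′ : ∀ x′ y′ → f₁ x′ y′ ≈ u → f₂ x′ y′ ≈ v → x′ ≈ x × y′ ≈ y
      unique′ x′ y′ f₁≈u′ f₂≈v′ =
        unique x′ y′ (+-cong (*-congˡ f₂≈v′) (-‿cong (P-cong f₁≈u′))) f₁≈u′

  shear-isPermutation : ∀ {κ μ} {G : Carrier → Carrier} → ¬ κ ≈ 0# → ¬ μ ≈ 0# →
    (∀ {y y′} → y ≈ y′ → G y ≈ G y′) →
    IsPermutation² F (λ x y → κ * y) (λ x y → μ * x + G y)
  shear-isPermutation {κ} {μ} {G} κ≉0 μ≉0 G-cong u v =
    (x₀ , y₀) , (κy₀≈u , μx₀+Gy₀≈v) , unique
    where
      y₀ x₀ : Carrier
      y₀ = proj₁ (division κ≉0 u)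
      κy₀≈u : κ * y₀ ≈ u
      κy₀≈u = proj₂ (division κ≉0 u)
      x₀ = proj₁ (division μ≉0 (v - G y₀))
      μx₀+Gy₀≈v : μ * x₀ + G y₀ ≈ v
      μx₀+Gy₀≈v = trans (+-congʳ (proj₂ (division μ≉0 (v - G y₀)))) (//-rightDividesˡ (G y₀) v)
      unique : ∀ x′ y′ → κ * y′ ≈ u → μ * x′ + G y′ ≈ v → x′ ≈ x₀ × y′ ≈ y₀
      unique x′ y′ κy′≈u μx′+Gy′≈v = x′≈x₀ , y′≈y₀
        where
          y′≈y₀ : y′ ≈ y₀
          y′≈y₀ = *-cancelˡ κ≉0 (trans κy′≈u (sym κy₀≈u))
          x′≈x₀ : x′ ≈ x₀
          x′≈x₀ = *-cancelˡ μ≉0 (∙-cancelʳ (G y₀) _ _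
            (trans (+-congˡ (G-cong (sym y′≈y₀))) (trans μx′+Gy′≈v (sym μx₀+Gy₀≈v))))

  Increment : (Carrier → Carrier → Carrier) → (d₁ d₂ p q r : Carrier) → Set (c ⊔ ℓ)
  Increment f d₁ d₂ p q r = ∀ x y → f (x + d₁) (y + d₂) ≈ f x y + affine p q r x y

  translation-collision : IsPermutation² F f₁ f₂ →
    f₁ (x + d₁) (y + d₂) ≈ f₁ x y → f₂ (x + d₁) (y + d₂) ≈ f₂ x y → d₁ ≈ 0# × d₂ ≈ 0#
  translation-collision {x = x} {d₁ = d₁} {y = y} {d₂ = d₂} perm e₁ e₂ =
    let x+d₁≈x , y+d₂≈y = IsPermutation²⇒injective perm e₁ e₂
    in  ∙-cancelˡ x d₁ 0# (trans x+d₁≈x (sym (+-identityʳ x))) ,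
        ∙-cancelˡ y d₂ 0# (trans y+d₂≈y (sym (+-identityʳ y)))

  increments-not-both-zero : IsPermutation² F f₁ f₂ → ¬ (d₁ ≈ 0# × d₂ ≈ 0#) →
    Increment f₁ d₁ d₂ p₁ q₁ r₁ → Increment f₂ d₁ d₂ p₂ q₂ r₂ →
    ∀ x y → affine p₁ q₁ r₁ x y ≈ 0# → ¬ affine p₂ q₂ r₂ x y ≈ 0#
  increments-not-both-zero perm d≉0 incr₁ incr₂ x y A₁≈0 A₂≈0 =
    d≉0 (translation-collision perm (fixed incr₁ A₁≈0) (fixed incr₂ A₂≈0))
    where
      fixed : ∀ {f p q r} → Increment f d₁ d₂ p q r → affine p q r x y ≈ 0# →
        f (x + d₁) (y + d₂) ≈ f x y
      fixed incr A≈0 = trans (incr x y) (trans (+-congˡ A≈0) (+-identityʳ _))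

  invariant-direction : IsPermutation² F f₁ f₂ → ¬ (d₁ ≈ 0# × d₂ ≈ 0#) →
    (∀ x y → f₁ (x + d₁) (y + d₂) ≈ f₁ x y) → Increment f₂ d₁ d₂ p q r →
    p ≈ 0# × q ≈ 0# × ¬ r ≈ 0#
  invariant-direction perm d≉0 invariant incr = nonvanishing-affine λ x y A≈0 →
    d≉0 (translation-collision perm (invariant x y)
                                    (trans (incr x y) (trans (+-congˡ A≈0) (+-identityʳ _))))

module Classification {c ℓ} (F : FiniteField c ℓ) (odd : OddCharacteristic F) where
  open FiniteField F
  open FieldLemmas F
  open PermutationLemmas F
  open IntegerCoefficients commRing using (solve; _:=_; _:+_; _:*_; _:-_; :-_; con)
  open import Algebra.Properties.Group +-group using (x∙y⁻¹≈ε⇒x≈y; x≈y⇒x∙y⁻¹≈ε)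
  open import Relation.Binary.Reasoning.Setoid setoid

  private variable
    a₁ a₃ a₄ a₅ b₁ b₂ b₃ b₄ b₅ a₁′ a₃′ a₄′ a₅′ b₁′ b₂′ b₃′ b₄′ b₅′ : Carrier
    f₂ : Carrier → Carrier → Carrier

  record Quadratic : Set c where
    constructor quadratic
    field x² xy y² x¹ y¹ : Carrier

  ⟦_⟧ : Quadratic → Carrier → Carrier → Carrier
  ⟦ quadratic b₁ b₂ b₃ b₄ b₅ ⟧ = F₂ F b₁ b₂ b₃ b₄ b₅

  ∂ˣ ∂ʸ : Quadratic → Carrier → Carrier → Carrier
  ∂ˣ (quadratic b₁ b₂ _ _ _) d₁ d₂ = two * b₁ * d₁ + b₂ * d₂
  ∂ʸ (quadratic _ b₂ b₃ _ _) d₁ d₂ = b₂ * d₁ + two * b₃ * d₂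

  ⟦⟧-increment : ∀ f d₁ d₂ → Increment ⟦ f ⟧ d₁ d₂ (∂ˣ f d₁ d₂) (∂ʸ f d₁ d₂) (⟦ f ⟧ d₁ d₂)
  ⟦⟧-increment (quadratic b₁ b₂ b₃ b₄ b₅) =
    solve 9 (λ b₁ b₂ b₃ b₄ b₅ d₁ d₂ x y →
      b₁ :* ((x :+ d₁) :* (x :+ d₁)) :+ b₂ :* ((x :+ d₁) :* (y :+ d₂)) :+ b₃ :* ((y
      :+ d₂) :* (y :+ d₂)) :+ b₄ :* (x :+ d₁) :+ b₅ :* (y :+ d₂)
      := b₁ :* (x :* x) :+ b₂ :* (x :* y) :+ b₃ :* (y :* y) :+ b₄ :* x :+ b₅ :* y :+ ((con (+ 2)
      :* b₁ :* d₁ :+ b₂ :* d₂) :* x :+ (b₂ :* d₁ :+ con (+ 2) :* b₃ :* d₂) :* y :+ (b₁ :* (d₁ :* d₁)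
      :+ b₂ :* (d₁ :* d₂) :+ b₃ :* (d₂ :* d₂) :+ b₄ :* d₁ :+ b₅ :* d₂))) refl
    b₁ b₂ b₃ b₄ b₅

  ⟦⟧[0,0] : ∀ b₁ b₂ b₃ b₄ b₅ → ⟦ quadratic b₁ b₂ b₃ b₄ b₅ ⟧ 0# 0# ≈ 0#
  ⟦⟧[0,0] =
    solve 5 (λ b₁ b₂ b₃ b₄ b₅ →
      b₁ :* (con (+ 0) :* con (+ 0)) :+ b₂ :* (con (+ 0) :* con (+ 0)) :+ b₃ :* (con (+ 0) :* con (+ 0))
      :+ b₄ :* con (+ 0) :+ b₅ :* con (+ 0)
      := con (+ 0)) refl

  ⟦⟧[0,1] : ∀ b₁ b₂ b₃ b₄ b₅ → ⟦ quadratic b₁ b₂ b₃ b₄ b₅ ⟧ 0# 1# ≈ b₃ + b₅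
  ⟦⟧[0,1] =
    solve 5 (λ b₁ b₂ b₃ b₄ b₅ →
      b₁ :* (con (+ 0) :* con (+ 0)) :+ b₂ :* (con (+ 0) :* con (+ 1)) :+ b₃ :* (con (+ 1) :* con (+ 1))
      :+ b₄ :* con (+ 0) :+ b₅ :* con (+ 1)
      := b₃ :+ b₅) refl

  F₁-as-quadratic : ∀ a₁ a₃ a₄ a₅ x y → F₁ F a₁ a₃ a₄ a₅ x y ≈ ⟦ quadratic a₁ 0# a₃ a₄ a₅ ⟧ x y
  F₁-as-quadratic =
    solve 6 (λ a₁ a₃ a₄ a₅ x y →
      a₁ :* (x :* x) :+ a₃ :* (y :* y) :+ a₄ :* x :+ a₅ :* y
      := a₁ :* (x :* x) :+ con (+ 0) :* (x :* y) :+ a₃ :* (y :* y) :+ a₄ :* x :+ a₅ :* y) refl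

  F₁-cong : a₁ ≈ a₁′ → a₃ ≈ a₃′ → a₄ ≈ a₄′ → a₅ ≈ a₅′ →
    ∀ x y → F₁ F a₁ a₃ a₄ a₅ x y ≈ F₁ F a₁′ a₃′ a₄′ a₅′ x y
  F₁-cong e₁ e₃ e₄ e₅ x y =
    +-cong (+-cong (+-cong (*-congʳ e₁) (*-congʳ e₃)) (*-congʳ e₄)) (*-congʳ e₅)

  F₂-cong : b₁ ≈ b₁′ → b₂ ≈ b₂′ → b₃ ≈ b₃′ → b₄ ≈ b₄′ → b₅ ≈ b₅′ →
    ∀ x y → F₂ F b₁ b₂ b₃ b₄ b₅ x y ≈ F₂ F b₁′ b₂′ b₃′ b₄′ b₅′ x y
  F₂-cong e₁ e₂ e₃ e₄ e₅ x y =
    +-cong (+-cong (+-cong (+-cong (*-congʳ e₁) (*-congʳ e₂)) (*-congʳ e₃)) (*-congʳ e₄))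
           (*-congʳ e₅)

  as-quadratics : ∀ {a₁ a₃ a₄ a₅} → IsPermutation² F (F₁ F a₁ a₃ a₄ a₅) f₂ →
    IsPermutation² F ⟦ quadratic a₁ 0# a₃ a₄ a₅ ⟧ f₂
  as-quadratics {a₁ = a₁} {a₃ = a₃} {a₄ = a₄} {a₅ = a₅} =
    IsPermutation²-resp (F₁-as-quadratic a₁ a₃ a₄ a₅) (λ _ _ → refl)

  IsPermutation²-swap : ∀ {a₁ a₃ a₄ a₅ b₁ b₂ b₃ b₄ b₅} →
    IsPermutation² F (F₁ F a₁ a₃ a₄ a₅) (F₂ F b₁ b₂ b₃ b₄ b₅) →
    IsPermutation² F (F₁ F a₃ a₁ a₅ a₄) (F₂ F b₃ b₂ b₁ b₅ b₄)
  IsPermutation²-swap {a₁} {a₃} {a₄} {a₅} {b₁} {b₂} {b₃} {b₄} {b₅} perm =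
    IsPermutation²-resp (λ x y → sym (F₁-swap a₁ a₃ a₄ a₅ x y))
                        (λ x y → sym (F₂-swap b₁ b₂ b₃ b₄ b₅ x y))
                        (IsPermutation²-flip perm)
    where
      F₁-swap : ∀ a₁ a₃ a₄ a₅ x y → F₁ F a₃ a₁ a₅ a₄ x y ≈ F₁ F a₁ a₃ a₄ a₅ y x
      F₁-swap =
        solve 6 (λ a₁ a₃ a₄ a₅ x y →
          a₃ :* (x :* x) :+ a₁ :* (y :* y) :+ a₅ :* x :+ a₄ :* y
          := a₁ :* (y :* y) :+ a₃ :* (x :* x) :+ a₄ :* y :+ a₅ :* x) refl
      F₂-swap : ∀ b₁ b₂ b₃ b₄ b₅ x y → F₂ F b₃ b₂ b₁ b₅ b₄ x y ≈ F₂ F b₁ b₂ b₃ b₄ b₅ y x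
      F₂-swap =
        solve 7 (λ b₁ b₂ b₃ b₄ b₅ x y →
          b₃ :* (x :* x) :+ b₂ :* (x :* y) :+ b₁ :* (y :* y) :+ b₅ :* x :+ b₄ :* y
          := b₁ :* (y :* y) :+ b₂ :* (y :* x) :+ b₃ :* (x :* x) :+ b₄ :* y :+ b₅ :* x) refl

  -- ⟦ f ⟧ and ⟦ g ⟧ vanish at the origin.
  isPermutation⇒unique-zero : ∀ {f g x y} → IsPermutation² F ⟦ f ⟧ ⟦ g ⟧ →
    ⟦ f ⟧ x y ≈ 0# → ⟦ g ⟧ x y ≈ 0# → x ≈ 0# × y ≈ 0#
  isPermutation⇒unique-zero {quadratic a₁ a₂ a₃ a₄ a₅} {quadratic b₁ b₂ b₃ b₄ b₅} perm f≈0 g≈0 =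
    IsPermutation²⇒injective perm (trans f≈0 (sym (⟦⟧[0,0] a₁ a₂ a₃ a₄ a₅)))
                                  (trans g≈0 (sym (⟦⟧[0,0] b₁ b₂ b₃ b₄ b₅)))

  det minor : Quadratic → Quadratic → Carrier → Carrier → Carrier
  det f g d₁ d₂   = ∂ˣ f d₁ d₂ * ∂ʸ g d₁ d₂ - ∂ˣ g d₁ d₂ * ∂ʸ f d₁ d₂
  minor f g d₁ d₂ = ∂ˣ f d₁ d₂ * ⟦ g ⟧ d₁ d₂ - ∂ˣ g d₁ d₂ * ⟦ f ⟧ d₁ d₂

  isPermutation⇒singular : ∀ {f g} → IsPermutation² F ⟦ f ⟧ ⟦ g ⟧ → ∀ t → ¬ ∂ˣ f 1# t ≈ 0# →
    det f g 1# t ≈ 0# × ¬ minor f g 1# t ≈ 0#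
  isPermutation⇒singular {f} {g} perm t ∂ˣf≉0 =
    no-common-zero⇒singular ∂ˣf≉0
      (increments-not-both-zero perm (1≉0 ∘ proj₁) (⟦⟧-increment f 1# t) (⟦⟧-increment g 1# t))

  record X²Consequences (a₁ a₃ a₄ a₅ b₁ b₂ b₃ b₄ b₅ : Carrier) : Set ℓ where
    field
      b₂≈0 : b₂ ≈ 0#
      δ≈0  : a₁ * b₃ - a₃ * b₁ ≈ 0#
      β≈0  : a₁ * b₅ - a₅ * b₁ ≈ 0#
      α≉0  : ¬ a₁ * b₄ - a₄ * b₁ ≈ 0#

  ∂ˣ[1,t] : ∀ a₁ a₃ a₄ a₅ t → ∂ˣ (quadratic a₁ 0# a₃ a₄ a₅) 1# t ≈ two * a₁
  ∂ˣ[1,t] =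
    solve 5 (λ a₁ a₃ a₄ a₅ t →
      con (+ 2) :* a₁ :* con (+ 1) :+ con (+ 0) :* t
      := con (+ 2) :* a₁) refl

  det[1,0] : ∀ a₁ a₃ a₄ a₅ b₁ b₂ b₃ b₄ b₅ →
    det (quadratic a₁ 0# a₃ a₄ a₅) (quadratic b₁ b₂ b₃ b₄ b₅) 1# 0# ≈ two * a₁ * b₂
  det[1,0] =
    solve 9 (λ a₁ a₃ a₄ a₅ b₁ b₂ b₃ b₄ b₅ →
      (con (+ 2) :* a₁ :* con (+ 1) :+ con (+ 0) :* con (+ 0)) :* (b₂ :* con (+ 1)
      :+ con (+ 2) :* b₃ :* con (+ 0)) :- (con (+ 2) :* b₁ :* con (+ 1) :+ b₂ :* con (+ 0)) :* (con (+ 0)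
      :* con (+ 1) :+ con (+ 2) :* a₃ :* con (+ 0))
      := con (+ 2) :* a₁ :* b₂) refl

  det[1,1] : ∀ a₁ a₃ a₄ a₅ b₁ b₃ b₄ b₅ →
    det (quadratic a₁ 0# a₃ a₄ a₅) (quadratic b₁ 0# b₃ b₄ b₅) 1# 1# ≈
    two * two * (a₁ * b₃ - a₃ * b₁)
  det[1,1] =
    solve 8 (λ a₁ a₃ a₄ a₅ b₁ b₃ b₄ b₅ →
      (con (+ 2) :* a₁ :* con (+ 1) :+ con (+ 0) :* con (+ 1)) :* (con (+ 0) :* con (+ 1)
      :+ con (+ 2) :* b₃ :* con (+ 1)) :- (con (+ 2) :* b₁ :* con (+ 1) :+ con (+ 0) :* con (+ 1))
      :* (con (+ 0) :* con (+ 1) :+ con (+ 2) :* a₃ :* con (+ 1))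
      := con (+ 2) :* con (+ 2) :* (a₁ :* b₃ :- a₃ :* b₁)) refl

  minor[1,0] : ∀ a₁ a₃ a₄ a₅ b₁ b₂ b₃ b₄ b₅ →
    minor (quadratic a₁ 0# a₃ a₄ a₅) (quadratic b₁ b₂ b₃ b₄ b₅) 1# 0# ≈
    two * (a₁ * b₄ - a₄ * b₁)
  minor[1,0] =
    solve 9 (λ a₁ a₃ a₄ a₅ b₁ b₂ b₃ b₄ b₅ →
      (con (+ 2) :* a₁ :* con (+ 1) :+ con (+ 0) :* con (+ 0)) :* (b₁ :* (con (+ 1) :* con (+ 1))
      :+ b₂ :* (con (+ 1) :* con (+ 0)) :+ b₃ :* (con (+ 0) :* con (+ 0)) :+ b₄ :* con (+ 1)
      :+ b₅ :* con (+ 0)) :- (con (+ 2) :* b₁ :* con (+ 1) :+ b₂ :* con (+ 0)) :* (a₁ :* (con (+ 1)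
      :* con (+ 1)) :+ con (+ 0) :* (con (+ 1) :* con (+ 0)) :+ a₃ :* (con (+ 0) :* con (+ 0))
      :+ a₄ :* con (+ 1) :+ a₅ :* con (+ 0))
      := con (+ 2) :* (a₁ :* b₄ :- a₄ :* b₁)) refl

  minor[1,t] : ∀ a₁ a₃ a₄ a₅ b₁ b₃ b₄ b₅ t →
    minor (quadratic a₁ 0# a₃ a₄ a₅) (quadratic b₁ 0# b₃ b₄ b₅) 1# t ≈
    two * ((a₁ * b₅ - a₅ * b₁) * t + (a₁ * b₄ - a₄ * b₁) + t * t * (a₁ * b₃ - a₃ * b₁))
  minor[1,t] =
    solve 9 (λ a₁ a₃ a₄ a₅ b₁ b₃ b₄ b₅ t →
      (con (+ 2) :* a₁ :* con (+ 1) :+ con (+ 0) :* t) :* (b₁ :* (con (+ 1) :* con (+ 1))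
      :+ con (+ 0) :* (con (+ 1) :* t) :+ b₃ :* (t :* t) :+ b₄ :* con (+ 1) :+ b₅ :* t)
      :- (con (+ 2) :* b₁ :* con (+ 1) :+ con (+ 0) :* t) :* (a₁ :* (con (+ 1) :* con (+ 1))
      :+ con (+ 0) :* (con (+ 1) :* t) :+ a₃ :* (t :* t) :+ a₄ :* con (+ 1) :+ a₅ :* t)
      := con (+ 2) :* ((a₁ :* b₅ :- a₅ :* b₁) :* t :+ (a₁ :* b₄ :- a₄ :* b₁) :+ t :* t :* (a₁
      :* b₃ :- a₃ :* b₁))) refl

  x²-consequences : ∀ {a₁ a₃ a₄ a₅ b₁ b₂ b₃ b₄ b₅} → ¬ a₁ ≈ 0# →
    IsPermutation² F (F₁ F a₁ a₃ a₄ a₅) (F₂ F b₁ b₂ b₃ b₄ b₅) →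
    X²Consequences a₁ a₃ a₄ a₅ b₁ b₂ b₃ b₄ b₅
  x²-consequences {a₁} {a₃} {a₄} {a₅} {b₁} {b₂} {b₃} {b₄} {b₅} a₁≉0 perm =
    record { b₂≈0 = b₂≈0 ; δ≈0 = δ≈0 ; β≈0 = β≈0 ; α≉0 = α≉0 }
    where
      f : Quadratic
      f = quadratic a₁ 0# a₃ a₄ a₅

      ∂ˣf≉0 : ∀ t → ¬ ∂ˣ f 1# t ≈ 0#
      ∂ˣf≉0 t = *-≉0 odd a₁≉0 ∘ trans (sym (∂ˣ[1,t] a₁ a₃ a₄ a₅ t))

      perm₀ : IsPermutation² F ⟦ f ⟧ ⟦ quadratic b₁ b₂ b₃ b₄ b₅ ⟧
      perm₀ = as-quadratics perm

      b₂≈0 : b₂ ≈ 0#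
      b₂≈0 = a*x≈0⇒x≈0 (*-≉0 odd a₁≉0) (trans (sym (det[1,0] a₁ a₃ a₄ a₅ b₁ b₂ b₃ b₄ b₅))
                                               (proj₁ (isPermutation⇒singular perm₀ 0# (∂ˣf≉0 0#))))

      perm₁ : IsPermutation² F ⟦ f ⟧ ⟦ quadratic b₁ 0# b₃ b₄ b₅ ⟧
      perm₁ = IsPermutation²-resp (λ _ _ → refl) (F₂-cong refl b₂≈0 refl refl refl) perm₀

      δ≈0 : a₁ * b₃ - a₃ * b₁ ≈ 0#
      δ≈0 = a*x≈0⇒x≈0 (*-≉0 odd odd) (trans (sym (det[1,1] a₁ a₃ a₄ a₅ b₁ b₃ b₄ b₅))
                                            (proj₁ (isPermutation⇒singular perm₁ 1# (∂ˣf≉0 1#))))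

      α≉0 : ¬ a₁ * b₄ - a₄ * b₁ ≈ 0#
      α≉0 α≈0 = proj₂ (isPermutation⇒singular perm₀ 0# (∂ˣf≉0 0#))
        (trans (minor[1,0] a₁ a₃ a₄ a₅ b₁ b₂ b₃ b₄ b₅) (trans (*-congˡ α≈0) (zeroʳ two)))

      β≈0 : a₁ * b₅ - a₅ * b₁ ≈ 0#
      β≈0 = linear-nonvanishing λ t βt+α≈0 → proj₂ (isPermutation⇒singular perm₁ t (∂ˣf≉0 t)) (begin
        minor f (quadratic b₁ 0# b₃ b₄ b₅) 1# t
          ≈⟨ minor[1,t] a₁ a₃ a₄ a₅ b₁ b₃ b₄ b₅ t ⟩
        two * ((a₁ * b₅ - a₅ * b₁) * t + (a₁ * b₄ - a₄ * b₁) + t * t * (a₁ * b₃ - a₃ * b₁))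
          ≈⟨ *-congˡ (trans (w+a*x≈w δ≈0 _ _) βt+α≈0) ⟩
        two * 0#
          ≈⟨ zeroʳ two ⟩
        0# ∎)

  cross-minors : ∀ a₁ b₁ p q r s →
    a₁ * (p * s - q * r) ≈ p * (a₁ * s - q * b₁) - q * (a₁ * r - p * b₁)
  cross-minors =
    solve 6 (λ a₁ b₁ p q r s →
      a₁ :* (p :* s :- q :* r)
      := p :* (a₁ :* s :- q :* b₁) :- q :* (a₁ :* r :- p :* b₁)) refl

  x²⇒swapped-Cond-ii : ∀ {a₁ a₃ a₄ a₅ b₁ b₂ b₃ b₄ b₅} → ¬ a₁ ≈ 0# →
    IsPermutation² F (F₁ F a₁ a₃ a₄ a₅) (F₂ F b₁ b₂ b₃ b₄ b₅) →
    Cond-ii F a₃ a₁ a₅ a₄ b₃ b₂ b₁ b₅ b₄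
  x²⇒swapped-Cond-ii {a₁} {a₃} {a₄} {a₅} {b₁} {b₂} {b₃} {b₄} {b₅} a₁≉0 perm =
    a₃≈0 , a₁≉0 , a₅≉0 , b₃≈0 , b₂≈0 , β≈0 , a₅b₄-a₄b₅≉0
    where
      open X²Consequences (x²-consequences a₁≉0 perm)

      a₃≈0 : a₃ ≈ 0#
      a₃≈0 = decidable-stable (a₃ ≟ 0#) λ a₃≉0 →
        X²Consequences.α≉0 (x²-consequences a₃≉0 (IsPermutation²-swap perm)) (a*x≈0⇒x≈0 a₁≉0 (begin
          a₁ * (a₃ * b₅ - a₅ * b₃)                            ≈⟨ cross-minors a₁ b₁ a₃ a₅ b₃ b₅ ⟩
          a₃ * (a₁ * b₅ - a₅ * b₁) - a₅ * (a₁ * b₃ - a₃ * b₁) ≈⟨ w-a*x≈w δ≈0 _ _ ⟩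
          a₃ * (a₁ * b₅ - a₅ * b₁)                            ≈⟨ *-congˡ β≈0 ⟩
          a₃ * 0#                                              ≈⟨ zeroʳ a₃ ⟩
          0#                                                   ∎))

      b₃≈0 : b₃ ≈ 0#
      b₃≈0 = a*x≈0⇒x≈0 a₁≉0 (trans (x∙y⁻¹≈ε⇒x≈y _ _ δ≈0) (trans (*-congʳ a₃≈0) (zeroˡ b₁)))

      a₅≉0 : ¬ a₅ ≈ 0#
      a₅≉0 a₅≈0 = 1≉0 (proj₂ (isPermutation⇒unique-zero (as-quadratics perm)
          (trans (⟦⟧[0,1] a₁ 0# a₃ a₄ a₅) (trans (+-cong a₃≈0 a₅≈0) (+-identityʳ 0#)))
          (trans (⟦⟧[0,1] b₁ b₂ b₃ b₄ b₅) (trans (+-cong b₃≈0 b₅≈0) (+-identityʳ 0#)))))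
        where
          b₅≈0 : b₅ ≈ 0#
          b₅≈0 = a*x≈0⇒x≈0 a₁≉0 (trans (x∙y⁻¹≈ε⇒x≈y _ _ β≈0) (trans (*-congʳ a₅≈0) (zeroˡ b₁)))

      a₅b₄-a₄b₅≉0 : ¬ a₅ * b₄ - a₄ * b₅ ≈ 0#
      a₅b₄-a₄b₅≉0 a₅b₄-a₄b₅≈0 = α≉0 (a*x≈0⇒x≈0 a₅≉0 (begin
        a₅ * (a₁ * b₄ - a₄ * b₁)                            ≈⟨ w-a*x≈w β≈0 _ _ ⟨
        a₅ * (a₁ * b₄ - a₄ * b₁) - a₄ * (a₁ * b₅ - a₅ * b₁) ≈⟨ cross-minors a₁ b₁ a₅ a₄ b₅ b₄ ⟨
        a₁ * (a₅ * b₄ - a₄ * b₅)                            ≈⟨ *-congˡ a₅b₄-a₄b₅≈0 ⟩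
        a₁ * 0#                                              ≈⟨ zeroʳ a₁ ⟩
        0#                                                   ∎))

  F₁-kernel-invariant : ∀ a₄ a₅ x y → F₁ F 0# 0# a₄ a₅ (x + a₅) (y + - a₄) ≈ F₁ F 0# 0# a₄ a₅ x y
  F₁-kernel-invariant =
    solve 4 (λ a₄ a₅ x y →
      con (+ 0) :* ((x :+ a₅) :* (x :+ a₅)) :+ con (+ 0) :* ((y :+ :- a₄) :* (y :+
      :- a₄)) :+ a₄ :* (x :+ a₅) :+ a₅ :* (y :+ :- a₄)
      := con (+ 0) :* (x :* x) :+ con (+ 0) :* (y :* y) :+ a₄ :* x :+ a₅ :* y) refl

  record KernelConsequences (a₄ a₅ b₁ b₂ b₃ b₄ b₅ : Carrier) : Set ℓ where
    field
      P≈0 : two * a₅ * b₁ - a₄ * b₂ ≈ 0#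
      Q≈0 : b₂ * a₅ - two * a₄ * b₃ ≈ 0#
      K≈0 : a₅ * a₅ * b₁ - a₄ * a₅ * b₂ + b₃ * (a₄ * a₄) ≈ 0#
      M≉0 : ¬ a₄ * b₅ - a₅ * b₄ ≈ 0#

  ∂ˣ[a₅,-a₄] : ∀ a₄ a₅ b₁ b₂ b₃ b₄ b₅ →
    ∂ˣ (quadratic b₁ b₂ b₃ b₄ b₅) a₅ (- a₄) ≈ two * a₅ * b₁ - a₄ * b₂
  ∂ˣ[a₅,-a₄] =
    solve 7 (λ a₄ a₅ b₁ b₂ b₃ b₄ b₅ →
      con (+ 2) :* b₁ :* a₅ :+ b₂ :* (:- a₄)
      := con (+ 2) :* a₅ :* b₁ :- a₄ :* b₂) refl

  ∂ʸ[a₅,-a₄] : ∀ a₄ a₅ b₁ b₂ b₃ b₄ b₅ →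
    ∂ʸ (quadratic b₁ b₂ b₃ b₄ b₅) a₅ (- a₄) ≈ b₂ * a₅ - two * a₄ * b₃
  ∂ʸ[a₅,-a₄] =
    solve 7 (λ a₄ a₅ b₁ b₂ b₃ b₄ b₅ →
      b₂ :* a₅ :+ con (+ 2) :* b₃ :* (:- a₄)
      := b₂ :* a₅ :- con (+ 2) :* a₄ :* b₃) refl

  ⟦⟧[a₅,-a₄] : ∀ a₄ a₅ b₁ b₂ b₃ b₄ b₅ →
    ⟦ quadratic b₁ b₂ b₃ b₄ b₅ ⟧ a₅ (- a₄) ≈
    (a₅ * a₅ * b₁ - a₄ * a₅ * b₂ + b₃ * (a₄ * a₄)) - (a₄ * b₅ - a₅ * b₄)
  ⟦⟧[a₅,-a₄] =
    solve 7 (λ a₄ a₅ b₁ b₂ b₃ b₄ b₅ →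
      b₁ :* (a₅ :* a₅) :+ b₂ :* (a₅ :* (:- a₄)) :+ b₃ :* ((:- a₄) :* (:- a₄)) :+ b₄ :* a₅
      :+ b₅ :* (:- a₄)
      := (a₅ :* a₅ :* b₁ :- a₄ :* a₅ :* b₂ :+ b₃ :* (a₄ :* a₄)) :- (a₄ :* b₅ :- a₅ :* b₄)) refl

  two*K : ∀ a₄ a₅ b₁ b₂ b₃ →
    two * (a₅ * a₅ * b₁ - a₄ * a₅ * b₂ + b₃ * (a₄ * a₄)) ≈
    a₅ * (two * a₅ * b₁ - a₄ * b₂) - a₄ * (b₂ * a₅ - two * a₄ * b₃)
  two*K =
    solve 5 (λ a₄ a₅ b₁ b₂ b₃ →
      con (+ 2) :* (a₅ :* a₅ :* b₁ :- a₄ :* a₅ :* b₂ :+ b₃ :* (a₄ :* a₄))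
      := a₅ :* (con (+ 2) :* a₅ :* b₁ :- a₄ :* b₂) :- a₄ :* (b₂ :* a₅ :- con (+ 2) :* a₄ :* b₃)) refl

  -- Along the kernel direction (a₅ , - a₄) of f₁ = a₄ x + a₅ y, f₂ must have a nowhere
  -- vanishing increment.
  linear-consequences : ∀ {a₄ a₅ b₁ b₂ b₃ b₄ b₅} → ¬ a₅ ≈ 0# →
    IsPermutation² F (F₁ F 0# 0# a₄ a₅) (F₂ F b₁ b₂ b₃ b₄ b₅) →
    KernelConsequences a₄ a₅ b₁ b₂ b₃ b₄ b₅
  linear-consequences {a₄} {a₅} {b₁} {b₂} {b₃} {b₄} {b₅} a₅≉0 perm =
    record { P≈0 = P≈0 ; Q≈0 = Q≈0 ; K≈0 = K≈0 ; M≉0 = M≉0 }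
    where
      g : Quadratic
      g = quadratic b₁ b₂ b₃ b₄ b₅
      increment-nowhere-zero : ∂ˣ g a₅ (- a₄) ≈ 0# × ∂ʸ g a₅ (- a₄) ≈ 0# × ¬ ⟦ g ⟧ a₅ (- a₄) ≈ 0#
      increment-nowhere-zero = invariant-direction perm (a₅≉0 ∘ proj₁) (F₁-kernel-invariant a₄ a₅)
                                                   (⟦⟧-increment g a₅ (- a₄))

      P≈0 : two * a₅ * b₁ - a₄ * b₂ ≈ 0#
      P≈0 = trans (sym (∂ˣ[a₅,-a₄] a₄ a₅ b₁ b₂ b₃ b₄ b₅)) (proj₁ increment-nowhere-zero)
      Q≈0 : b₂ * a₅ - two * a₄ * b₃ ≈ 0#
      Q≈0 = trans (sym (∂ʸ[a₅,-a₄] a₄ a₅ b₁ b₂ b₃ b₄ b₅)) (proj₁ (proj₂ increment-nowhere-zero))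

      K≈0 : a₅ * a₅ * b₁ - a₄ * a₅ * b₂ + b₃ * (a₄ * a₄) ≈ 0#
      K≈0 = a*x≈0⇒x≈0 odd (begin
        two * (a₅ * a₅ * b₁ - a₄ * a₅ * b₂ + b₃ * (a₄ * a₄))             ≈⟨ two*K a₄ a₅ b₁ b₂ b₃ ⟩
        a₅ * (two * a₅ * b₁ - a₄ * b₂) - a₄ * (b₂ * a₅ - two * a₄ * b₃) ≈⟨ w-a*x≈w Q≈0 _ _ ⟩
        a₅ * (two * a₅ * b₁ - a₄ * b₂)                                  ≈⟨ *-congˡ P≈0 ⟩
        a₅ * 0#                                                          ≈⟨ zeroʳ a₅ ⟩
        0#                                                               ∎)

      M≉0 : ¬ a₄ * b₅ - a₅ * b₄ ≈ 0#
      M≉0 M≈0 = proj₂ (proj₂ increment-nowhere-zero)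
        (trans (⟦⟧[a₅,-a₄] a₄ a₅ b₁ b₂ b₃ b₄ b₅) (x≈y⇒x∙y⁻¹≈ε (trans K≈0 (sym M≈0))))

  a₅y⇒Cond-i : ∀ {a₁ a₃ a₄ a₅ b₁ b₂ b₃ b₄ b₅} → a₁ ≈ 0# → a₃ ≈ 0# → a₄ ≈ 0# → ¬ a₅ ≈ 0# →
    IsPermutation² F (F₁ F a₁ a₃ a₄ a₅) (F₂ F b₁ b₂ b₃ b₄ b₅) →
    Cond-i F a₁ a₃ a₄ a₅ b₁ b₂ b₃ b₄ b₅
  a₅y⇒Cond-i {a₅ = a₅} {b₁} {b₂} {b₃} {b₄} {b₅} a₁≈0 a₃≈0 a₄≈0 a₅≉0 perm =
    a₁≈0 , a₃≈0 , a₄≈0 , a₅≉0 , b₁≈0 , b₂≈0 , b₄≉0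
    where
      open KernelConsequences (linear-consequences a₅≉0
        (IsPermutation²-resp (F₁-cong a₁≈0 a₃≈0 a₄≈0 refl) (λ _ _ → refl) perm))

      P[a₄=0] : ∀ a₅ b₁ b₂ → two * a₅ * b₁ - 0# * b₂ ≈ two * a₅ * b₁
      P[a₄=0] =
        solve 3 (λ a₅ b₁ b₂ → con (+ 2) :* a₅ :* b₁ :- con (+ 0) :* b₂ := con (+ 2) :* a₅ :* b₁) refl
      Q[a₄=0] : ∀ a₅ b₂ b₃ → b₂ * a₅ - two * 0# * b₃ ≈ a₅ * b₂
      Q[a₄=0] =
        solve 3 (λ a₅ b₂ b₃ → b₂ :* a₅ :- con (+ 2) :* con (+ 0) :* b₃ := a₅ :* b₂) refl
      M[a₄=0,b₄=0] : ∀ a₅ b₅ → 0# * b₅ - a₅ * 0# ≈ 0#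
      M[a₄=0,b₄=0] =
        solve 2 (λ a₅ b₅ → con (+ 0) :* b₅ :- a₅ :* con (+ 0) := con (+ 0)) refl

      b₁≈0 : b₁ ≈ 0#
      b₁≈0 = a*x≈0⇒x≈0 (*-≉0 odd a₅≉0) (trans (sym (P[a₄=0] a₅ b₁ b₂)) P≈0)
      b₂≈0 : b₂ ≈ 0#
      b₂≈0 = a*x≈0⇒x≈0 a₅≉0 (trans (sym (Q[a₄=0] a₅ b₂ b₃)) Q≈0)
      b₄≉0 : ¬ b₄ ≈ 0#
      b₄≉0 b₄≈0 = M≉0 (trans (+-congˡ (-‿cong (*-congˡ b₄≈0))) (M[a₄=0,b₄=0] a₅ b₅))

  linear⇒Cond-iii : a₁ ≈ 0# → a₃ ≈ 0# → ¬ a₄ ≈ 0# → ¬ a₅ ≈ 0# →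
    IsPermutation² F (F₁ F a₁ a₃ a₄ a₅) (F₂ F b₁ b₂ b₃ b₄ b₅) →
    Cond-iii F a₁ a₃ a₄ a₅ b₁ b₂ b₃ b₄ b₅
  linear⇒Cond-iii a₁≈0 a₃≈0 a₄≉0 a₅≉0 perm = a₁≈0 , a₃≈0 , a₄≉0 , a₅≉0 , K≈0 , Q≈0 , M≉0
    where
      open KernelConsequences (linear-consequences a₅≉0
        (IsPermutation²-resp (F₁-cong a₁≈0 a₃≈0 refl refl) (λ _ _ → refl) perm))

  constant⇒¬isPermutation : a₁ ≈ 0# → a₃ ≈ 0# → a₄ ≈ 0# → a₅ ≈ 0# →
    ¬ IsPermutation² F (F₁ F a₁ a₃ a₄ a₅) f₂
  constant⇒¬isPermutation a₁≈0 a₃≈0 a₄≈0 a₅≈0 perm =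
    let (x , y) , (f₁≈1 , _) , _ = perm 1# 0#
    in 1≉0 (trans (sym f₁≈1) (trans (F₁-cong a₁≈0 a₃≈0 a₄≈0 a₅≈0 x y) (F₁[0,0,0,0] x y)))
    where
      F₁[0,0,0,0] : ∀ x y → F₁ F 0# 0# 0# 0# x y ≈ 0#
      F₁[0,0,0,0] =
        solve 2 (λ x y →
          con (+ 0) :* (x :* x) :+ con (+ 0) :* (y :* y) :+ con (+ 0) :* x :+ con (+ 0) :* y
          := con (+ 0)) refl

  isPermutation⇒CondUpToSwap : IsPermutation² F (F₁ F a₁ a₃ a₄ a₅) (F₂ F b₁ b₂ b₃ b₄ b₅) →
    CondUpToSwap F a₁ a₃ a₄ a₅ b₁ b₂ b₃ b₄ b₅
  isPermutation⇒CondUpToSwap {a₁} {a₃} {a₄} {a₅} perm with a₁ ≟ 0# | a₃ ≟ 0# | a₄ ≟ 0# | a₅ ≟ 0#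
  ... | no a₁≉0 | _ | _ | _ =
    inj₂ (inj₂ (inj₁ (x²⇒swapped-Cond-ii a₁≉0 perm)))
  ... | yes _ | no a₃≉0 | _ | _ =
    inj₁ (inj₂ (inj₁ (x²⇒swapped-Cond-ii a₃≉0 (IsPermutation²-swap perm))))
  ... | yes a₁≈0 | yes a₃≈0 | yes a₄≈0 | yes a₅≈0 =
    ⊥-elim (constant⇒¬isPermutation a₁≈0 a₃≈0 a₄≈0 a₅≈0 perm)
  ... | yes a₁≈0 | yes a₃≈0 | yes a₄≈0 | no a₅≉0 =
    inj₁ (inj₁ (a₅y⇒Cond-i a₁≈0 a₃≈0 a₄≈0 a₅≉0 perm))
  ... | yes a₁≈0 | yes a₃≈0 | no a₄≉0 | yes a₅≈0 =
    inj₂ (inj₁ (a₅y⇒Cond-i a₃≈0 a₁≈0 a₅≈0 a₄≉0 (IsPermutation²-swap perm)))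
  ... | yes a₁≈0 | yes a₃≈0 | no a₄≉0 | no a₅≉0 =
    inj₁ (inj₂ (inj₂ (linear⇒Cond-iii a₁≈0 a₃≈0 a₄≉0 a₅≉0 perm)))

  quad : Carrier → Carrier → Carrier → Carrier
  quad p q y = p * (y * y) + q * y

  quad-cong : ∀ {p q y y′} → y ≈ y′ → quad p q y ≈ quad p q y′
  quad-cong y≈y′ = +-cong (*-congˡ (*-cong y≈y′ y≈y′)) (*-congˡ y≈y′)

  Cond-i⇒isPermutation : Cond-i F a₁ a₃ a₄ a₅ b₁ b₂ b₃ b₄ b₅ →
    IsPermutation² F (F₁ F a₁ a₃ a₄ a₅) (F₂ F b₁ b₂ b₃ b₄ b₅)
  Cond-i⇒isPermutation {a₁} {a₃} {a₄} {a₅} {b₁} {b₂} {b₃} {b₄} {b₅}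
                       (a₁≈0 , a₃≈0 , a₄≈0 , a₅≉0 , b₁≈0 , b₂≈0 , b₄≉0) =
    IsPermutation²-resp f₁≈ f₂≈ (shear-isPermutation a₅≉0 b₄≉0 quad-cong)
    where
      F₁[0,0,0,a₅] : ∀ a₅ x y → F₁ F 0# 0# 0# a₅ x y ≈ a₅ * y
      F₁[0,0,0,a₅] =
        solve 3 (λ a₅ x y →
          con (+ 0) :* (x :* x) :+ con (+ 0) :* (y :* y) :+ con (+ 0) :* x :+ a₅ :* y
          := a₅ :* y) refl
      F₂[0,0,b₃,b₄,b₅] : ∀ b₃ b₄ b₅ x y → F₂ F 0# 0# b₃ b₄ b₅ x y ≈ b₄ * x + quad b₃ b₅ y
      F₂[0,0,b₃,b₄,b₅] =
        solve 5 (λ b₃ b₄ b₅ x y →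
          con (+ 0) :* (x :* x) :+ con (+ 0) :* (x :* y) :+ b₃ :* (y :* y) :+ b₄ :* x
          :+ b₅ :* y
          := b₄ :* x :+ (b₃ :* (y :* y) :+ b₅ :* y)) refl
      f₁≈ : ∀ x y → a₅ * y ≈ F₁ F a₁ a₃ a₄ a₅ x y
      f₁≈ x y = sym (trans (F₁-cong a₁≈0 a₃≈0 a₄≈0 refl x y) (F₁[0,0,0,a₅] a₅ x y))
      f₂≈ : ∀ x y → b₄ * x + quad b₃ b₅ y ≈ F₂ F b₁ b₂ b₃ b₄ b₅ x y
      f₂≈ x y = sym (trans (F₂-cong b₁≈0 b₂≈0 refl refl refl x y) (F₂[0,0,b₃,b₄,b₅] b₃ b₄ b₅ x y))

  F₁[0,a₃,a₄,a₅] : ∀ a₃ a₄ a₅ x y → F₁ F 0# a₃ a₄ a₅ x y ≈ a₄ * x + quad a₃ a₅ y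
  F₁[0,a₃,a₄,a₅] =
    solve 5 (λ a₃ a₄ a₅ x y →
      con (+ 0) :* (x :* x) :+ a₃ :* (y :* y) :+ a₄ :* x :+ a₅ :* y
      := a₄ :* x :+ (a₃ :* (y :* y) :+ a₅ :* y)) refl

  a₄F₂-b₄F₁ : ∀ a₃ a₄ a₅ b₃ b₄ b₅ x y →
    a₄ * F₂ F 0# 0# b₃ b₄ b₅ x y - b₄ * F₁ F 0# a₃ a₄ a₅ x y ≈
    (a₄ * b₅ - a₅ * b₄) * y - y * y * (a₃ * b₄ - a₄ * b₃)
  a₄F₂-b₄F₁ =
    solve 8 (λ a₃ a₄ a₅ b₃ b₄ b₅ x y →
      a₄ :* (con (+ 0) :* (x :* x) :+ con (+ 0) :* (x :* y) :+ b₃ :* (y :* y) :+ b₄ :* x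
      :+ b₅ :* y) :- b₄ :* (con (+ 0) :* (x :* x) :+ a₃ :* (y :* y) :+ a₄ :* x :+ a₅ :* y)
      := (a₄ :* b₅ :- a₅ :* b₄) :* y :- y :* y :* (a₃ :* b₄ :- a₄ :* b₃)) refl

  -- a₄ f₂ - b₄ f₁ = (a₄b₅ - a₅b₄) y and f₁ = a₄ x + a₃y² + a₅y form a shear.
  Cond-ii⇒isPermutation : Cond-ii F a₁ a₃ a₄ a₅ b₁ b₂ b₃ b₄ b₅ →
    IsPermutation² F (F₁ F a₁ a₃ a₄ a₅) (F₂ F b₁ b₂ b₃ b₄ b₅)
  Cond-ii⇒isPermutation {a₁} {a₃} {a₄} {a₅} {b₁} {b₂} {b₃} {b₄} {b₅}
                        (a₁≈0 , _ , a₄≉0 , b₁≈0 , b₂≈0 , δ≈0 , c≉0) =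
    IsPermutation²-eliminate a₄≉0 *-congˡ
      (IsPermutation²-resp eliminated≈ f₁≈ (shear-isPermutation c≉0 a₄≉0 quad-cong))
    where
      f₁≈ : ∀ x y → a₄ * x + quad a₃ a₅ y ≈ F₁ F a₁ a₃ a₄ a₅ x y
      f₁≈ x y = sym (trans (F₁-cong a₁≈0 refl refl refl x y) (F₁[0,a₃,a₄,a₅] a₃ a₄ a₅ x y))
      eliminated≈ : ∀ x y →
        (a₄ * b₅ - a₅ * b₄) * y ≈ a₄ * F₂ F b₁ b₂ b₃ b₄ b₅ x y - b₄ * F₁ F a₁ a₃ a₄ a₅ x y
      eliminated≈ x y = sym (begin
        a₄ * F₂ F b₁ b₂ b₃ b₄ b₅ x y - b₄ * F₁ F a₁ a₃ a₄ a₅ x y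
          ≈⟨ +-cong (*-congˡ (F₂-cong b₁≈0 b₂≈0 refl refl refl x y))
                    (-‿cong (*-congˡ (F₁-cong a₁≈0 refl refl refl x y))) ⟩
        a₄ * F₂ F 0# 0# b₃ b₄ b₅ x y - b₄ * F₁ F 0# a₃ a₄ a₅ x y
          ≈⟨ a₄F₂-b₄F₁ a₃ a₄ a₅ b₃ b₄ b₅ x y ⟩
        (a₄ * b₅ - a₅ * b₄) * y - y * y * (a₃ * b₄ - a₄ * b₃)
          ≈⟨ w-a*x≈w δ≈0 _ _ ⟩
        (a₄ * b₅ - a₅ * b₄) * y ∎)

  F₁[0,0,a₄,a₅] : ∀ a₄ a₅ x y → F₁ F 0# 0# a₄ a₅ x y ≈ a₄ * x + a₅ * y
  F₁[0,0,a₄,a₅] =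
    solve 4 (λ a₄ a₅ x y →
      con (+ 0) :* (x :* x) :+ con (+ 0) :* (y :* y) :+ a₄ :* x :+ a₅ :* y
      := a₄ :* x :+ a₅ :* y) refl

  a₄²F₂-quad : ∀ a₄ a₅ b₁ b₂ b₃ b₄ b₅ x y →
    a₄ * a₄ * F₂ F b₁ b₂ b₃ b₄ b₅ x y - quad b₁ (a₄ * b₄) (a₄ * x + a₅ * y) ≈
    a₄ * (a₄ * b₅ - a₅ * b₄) * y + y * y * (a₅ * a₅ * b₁ - a₄ * a₅ * b₂ + b₃ * (a₄ * a₄))
    - (a₄ * x + a₅ * y) * y * (two * a₅ * b₁ - a₄ * b₂)
  a₄²F₂-quad =
    solve 9 (λ a₄ a₅ b₁ b₂ b₃ b₄ b₅ x y →
      a₄ :* a₄ :* (b₁ :* (x :* x) :+ b₂ :* (x :* y) :+ b₃ :* (y :* y) :+ b₄ :* x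
      :+ b₅ :* y) :- (b₁ :* ((a₄ :* x :+ a₅ :* y) :* (a₄ :* x :+ a₅ :* y)) :+ a₄ :* b₄ :* (a₄
      :* x :+ a₅ :* y))
      := a₄ :* (a₄ :* b₅ :- a₅ :* b₄) :* y :+ y :* y :* (a₅ :* a₅ :* b₁ :- a₄ :* a₅ :* b₂
      :+ b₃ :* (a₄ :* a₄)) :- (a₄ :* x :+ a₅ :* y) :* y :* (con (+ 2) :* a₅ :* b₁
      :- a₄ :* b₂)) refl

  a₅*P : ∀ a₄ a₅ b₁ b₂ b₃ →
    a₅ * (two * a₅ * b₁ - a₄ * b₂) ≈
    two * (a₅ * a₅ * b₁ - a₄ * a₅ * b₂ + b₃ * (a₄ * a₄)) + a₄ * (b₂ * a₅ - two * a₄ * b₃)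
  a₅*P =
    solve 5 (λ a₄ a₅ b₁ b₂ b₃ →
      a₅ :* (con (+ 2) :* a₅ :* b₁ :- a₄ :* b₂)
      := con (+ 2) :* (a₅ :* a₅ :* b₁ :- a₄ :* a₅ :* b₂ :+ b₃ :* (a₄ :* a₄)) :+ a₄ :* (b₂ :* a₅
      :- con (+ 2) :* a₄ :* b₃)) refl

  -- With u = f₁ = a₄ x + a₅ y, the conditions make a₄² f₂ - b₁ u² - a₄ b₄ u a multiple of y.
  Cond-iii⇒isPermutation : Cond-iii F a₁ a₃ a₄ a₅ b₁ b₂ b₃ b₄ b₅ →
    IsPermutation² F (F₁ F a₁ a₃ a₄ a₅) (F₂ F b₁ b₂ b₃ b₄ b₅)
  Cond-iii⇒isPermutation {a₁} {a₃} {a₄} {a₅} {b₁} {b₂} {b₃} {b₄} {b₅}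
                         (a₁≈0 , a₃≈0 , a₄≉0 , a₅≉0 , K≈0 , Q≈0 , c≉0) =
    IsPermutation²-eliminate (*-≉0 a₄≉0 a₄≉0) quad-cong
      (IsPermutation²-resp eliminated≈ f₁≈ (shear-isPermutation (*-≉0 a₄≉0 c≉0) a₄≉0 *-congˡ))
    where
      P≈0 : two * a₅ * b₁ - a₄ * b₂ ≈ 0#
      P≈0 = a*x≈0⇒x≈0 a₅≉0 (begin
        a₅ * (two * a₅ * b₁ - a₄ * b₂)
          ≈⟨ a₅*P a₄ a₅ b₁ b₂ b₃ ⟩
        two * (a₅ * a₅ * b₁ - a₄ * a₅ * b₂ + b₃ * (a₄ * a₄)) + a₄ * (b₂ * a₅ - two * a₄ * b₃)
          ≈⟨ w+a*x≈w Q≈0 _ _ ⟩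
        two * (a₅ * a₅ * b₁ - a₄ * a₅ * b₂ + b₃ * (a₄ * a₄))
          ≈⟨ *-congˡ K≈0 ⟩
        two * 0#
          ≈⟨ zeroʳ two ⟩
        0# ∎)

      u≈ : ∀ x y → F₁ F a₁ a₃ a₄ a₅ x y ≈ a₄ * x + a₅ * y
      u≈ x y = trans (F₁-cong a₁≈0 a₃≈0 refl refl x y) (F₁[0,0,a₄,a₅] a₄ a₅ x y)
      f₁≈ : ∀ x y → a₄ * x + a₅ * y ≈ F₁ F a₁ a₃ a₄ a₅ x y
      f₁≈ x y = sym (u≈ x y)
      eliminated≈ : ∀ x y → a₄ * (a₄ * b₅ - a₅ * b₄) * y ≈
        a₄ * a₄ * F₂ F b₁ b₂ b₃ b₄ b₅ x y - quad b₁ (a₄ * b₄) (F₁ F a₁ a₃ a₄ a₅ x y)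
      eliminated≈ x y = sym (begin
        a₄ * a₄ * F₂ F b₁ b₂ b₃ b₄ b₅ x y - quad b₁ (a₄ * b₄) (F₁ F a₁ a₃ a₄ a₅ x y)
          ≈⟨ +-congˡ (-‿cong (quad-cong (u≈ x y))) ⟩
        a₄ * a₄ * F₂ F b₁ b₂ b₃ b₄ b₅ x y - quad b₁ (a₄ * b₄) (a₄ * x + a₅ * y)
          ≈⟨ a₄²F₂-quad a₄ a₅ b₁ b₂ b₃ b₄ b₅ x y ⟩
        a₄ * (a₄ * b₅ - a₅ * b₄) * y + y * y * (a₅ * a₅ * b₁ - a₄ * a₅ * b₂ + b₃ * (a₄ * a₄))
        - (a₄ * x + a₅ * y) * y * (two * a₅ * b₁ - a₄ * b₂)
          ≈⟨ w-a*x≈w P≈0 _ _ ⟩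
        a₄ * (a₄ * b₅ - a₅ * b₄) * y + y * y * (a₅ * a₅ * b₁ - a₄ * a₅ * b₂ + b₃ * (a₄ * a₄))
          ≈⟨ w+a*x≈w K≈0 _ _ ⟩
        a₄ * (a₄ * b₅ - a₅ * b₄) * y ∎)

  Cond⇒isPermutation : Cond F a₁ a₃ a₄ a₅ b₁ b₂ b₃ b₄ b₅ →
    IsPermutation² F (F₁ F a₁ a₃ a₄ a₅) (F₂ F b₁ b₂ b₃ b₄ b₅)
  Cond⇒isPermutation (inj₁ i)          = Cond-i⇒isPermutation i
  Cond⇒isPermutation (inj₂ (inj₁ ii))  = Cond-ii⇒isPermutation ii
  Cond⇒isPermutation (inj₂ (inj₂ iii)) = Cond-iii⇒isPermutation iii

  CondUpToSwap⇒isPermutation : CondUpToSwap F a₁ a₃ a₄ a₅ b₁ b₂ b₃ b₄ b₅ →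
    IsPermutation² F (F₁ F a₁ a₃ a₄ a₅) (F₂ F b₁ b₂ b₃ b₄ b₅)
  CondUpToSwap⇒isPermutation (inj₁ cond)    = Cond⇒isPermutation cond
  CondUpToSwap⇒isPermutation (inj₂ swapped) = IsPermutation²-swap (Cond⇒isPermutation swapped)

proposition3p4 : ∀ {c ℓ : Level} (F : FiniteField c ℓ) → OddCharacteristic F →
    (a₁ a₃ a₄ a₅ b₁ b₂ b₃ b₄ b₅ : FiniteField.Carrier F) →
    IsPermutation² F (F₁ F a₁ a₃ a₄ a₅) (F₂ F b₁ b₂ b₃ b₄ b₅)
      ⇔ CondUpToSwap F a₁ a₃ a₄ a₅ b₁ b₂ b₃ b₄ b₅
proposition3p4 F odd a₁ a₃ a₄ a₅ b₁ b₂ b₃ b₄ b₅ =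
  mk⇔ isPermutation⇒CondUpToSwap CondUpToSwap⇒isPermutation
  where open Classification F odd
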